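{- Let $a,b\ge1$, $n=a+b$, $P=[a]\times[b]$. For every $v\in(\mathbb{R}^+)^P$, corresponding to $f:\hat P\to\mathbb{R}^+$ with $f(\hat 0)=f(\hat 1)=1$, and every $1\le i\le n-1$, $$\prod_{k=0}^{n-1}|\pi_{\mathcal{B}}^k(v)|_i=1,$$ where $|v|_i$ denotes the product of $f(x)$ over all $x$ in the $i$-th file of $P$.
   Context: $[a]\times[b]$ is ordered componentwise; $\hat P$ is $P$ with new minimum $\hat 0$ and maximum $\hat 1$; $\lessdot$ is the covering relation in $\hat P$. The $i$-th file of $P$ is $\{(i',j)\in P: j-i'+a=i\}$. For $x\in P$ the birational toggle $\phi_x$ changes only the value at $x$: $(\phi_x f)(x)=LR/f(x)$ with $L=\sum_{y\in\hat P,\,y\lessdot x} f(y)$ and $R$ the parallel sum of $\{f(y):y\in\hat P,\ y\gtrdot x\}$ (parallel sum of $s_1,\dots,s_m$ is $1/(1/s_1+\cdots+1/s_m)$). Birational promotion $\pi_{\mathcal{B}}$ toggles all elements of file 1, then of file 2, ..., then of file $n-1$. -}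

module Defs where

open import Data.Nat as ℕ using (ℕ; zero; suc; _∸_)
open import Data.Fin as Fin using (Fin; toℕ)
open import Data.Product using (_×_; _,_; ∃; Σ)
open import Data.Sum using (_⊎_)
open import Data.List using (List; []; _∷_; _++_; map; foldr; foldl; filter; concatMap; upTo; allFin)
open import Data.Bool using (Bool; true; false; if_then_else_)
open import Relation.Nullary using (¬_; yes; no; does)
import Data.Bool
open import Relation.Binary.PropositionalEquality using (_≡_)
open import Relation.Binary.Structures using (IsStrictTotalOrder)
open import Algebra.Structures using (IsCommutativeRing)

-- The real numbers, axiomatised as a Dedekind-complete ordered field
-- (unique up to isomorphism).  The inverse is a total function whose
-- value at 0 is unconstrained.

record Reals : Set₁ where
  infixl 6 _+_
  infixl 7 _*_
  field
    ℝ : Set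
    0# 1# : ℝ
    _+_ _*_ : ℝ → ℝ → ℝ
    -_ : ℝ → ℝ
    _⁻¹ : ℝ → ℝ
    _<_ : ℝ → ℝ → Set
    isCommutativeRing : IsCommutativeRing _≡_ _+_ _*_ -_ 0# 1#
    0≢1 : ¬ (0# ≡ 1#)
    inverseʳ : ∀ x → ¬ (x ≡ 0#) → x * (x ⁻¹) ≡ 1#
    isStrictTotalOrder : IsStrictTotalOrder _≡_ _<_
    +-mono-< : ∀ x y z → x < y → (x + z) < (y + z)
    *-pos : ∀ x y → 0# < x → 0# < y → 0# < (x * y)
  _≤_ : ℝ → ℝ → Set
  x ≤ y = (x < y) ⊎ (x ≡ y)
  field
    sup : (S : ℝ → Set) → ∃ S → (∃ λ u → ∀ x → S x → x ≤ u) →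
          ∃ λ s → (∀ x → S x → x ≤ s) × (∀ u → (∀ x → S x → x ≤ u) → s ≤ u)

module Promotion (R : Reals) where
  open Reals R

  -- elements of P, 0-based: (p , q) stands for (p+1 , q+1) ∈ [a]×[b]
  Elt : ℕ → ℕ → Set
  Elt a b = Fin a × Fin b

  Labelling : ℕ → ℕ → Set
  Labelling a b = Elt a b → ℝ

  data Hat (a b : ℕ) : Set where
    0̂ 1̂ : Hat a b
    ⟨_⟩ : Elt a b → Hat a b

  ext : ∀ {a b} → Labelling a b → Hat a b → ℝ
  ext v 0̂ = 1#
  ext v 1̂ = 1#
  ext v ⟨ x ⟩ = v x

  sumL : List ℝ → ℝ
  sumL = foldr _+_ 0#

  prodL : List ℝ → ℝ
  prodL = foldr _*_ 1#

  parSum : List ℝ → ℝ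
  parSum xs = (foldr (λ s acc → (s ⁻¹) + acc) 0# xs) ⁻¹

  prev : ∀ {m} → Fin m → List (Fin m)
  prev Fin.zero = []
  prev (Fin.suc i) = Fin.inject₁ i ∷ []

  next : ∀ {m} → Fin m → List (Fin m)
  next {m} i with suc (toℕ i) ℕ.<? m
  ... | yes lt = Fin.fromℕ< lt ∷ []
  ... | no _ = []

  -- nonempty-or-default: used to add 0̂ / 1̂ as the only cover when needed
  orElse : ∀ {A : Set} → List A → A → List A
  orElse [] d = d ∷ []
  orElse (y ∷ ys) d = y ∷ ys

  downCovers : ∀ {a b} → Elt a b → List (Hat a b)
  downCovers (p , q) =
    orElse (map (λ p′ → ⟨ (p′ , q) ⟩) (prev p) ++ map (λ q′ → ⟨ (p , q′) ⟩) (prev q)) 0̂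

  upCovers : ∀ {a b} → Elt a b → List (Hat a b)
  upCovers (p , q) =
    orElse (map (λ p′ → ⟨ (p′ , q) ⟩) (next p) ++ map (λ q′ → ⟨ (p , q′) ⟩) (next q)) 1̂

  _≟E_ : ∀ {a b} → (x y : Elt a b) → Bool
  (p , q) ≟E (p′ , q′) = does (p Fin.≟ p′) Data.Bool.∧ does (q Fin.≟ q′)

  toggle : ∀ {a b} → Elt a b → Labelling a b → Labelling a b
  toggle x v y =
    if x ≟E y
    then (sumL (map (ext v) (downCovers x)) * parSum (map (ext v) (upCovers x))) * (v x ⁻¹)
    else v y

  elements : (a b : ℕ) → List (Elt a b)
  elements a b = concatMap (λ p → map (λ q → (p , q)) (allFin b)) (allFin a)

  -- file index of (p,q): with 1-based coordinates (i′,j) = (p+1,q+1),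
  -- j - i′ + a = q - p + a
  fileOf : ∀ {a b} → Elt a b → ℕ
  fileOf {a} (p , q) = (toℕ q ℕ.+ a) ∸ toℕ p

  file : (a b : ℕ) → ℕ → List (Elt a b)
  file a b i = filter (λ x → fileOf x ℕ.≟ i) (elements a b)

  toggleAll : ∀ {a b} → List (Elt a b) → Labelling a b → Labelling a b
  toggleAll xs v = foldl (λ w x → toggle x w) v xs

  promotion : (a b : ℕ) → Labelling a b → Labelling a b
  promotion a b v =
    foldl (λ w i → toggleAll (file a b i) w) v (map suc (upTo ((a ℕ.+ b) ∸ 1)))

  iter : ∀ {A : Set} → ℕ → (A → A) → A → A
  iter zero g x = x
  iter (suc k) g x = g (iter k g x)

  fileProd : (a b : ℕ) → ℕ → Labelling a b → ℝ
  fileProd a b i v = prodL (map v (file a b i))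

module Submission where

-- Write g k j = |π^k v|_j for the file products of the k-th iterate.
-- Files 0 and n are empty, so g k 0 = g k n = 1.  The heart of the proof
-- is a local identity: toggling all of file j multiplies its product by
-- (|·|_{j-1} |·|_{j+1}) / |·|_j², because along a file the factor
-- L_x · R_x of consecutive elements telescopes into products
-- (y + z) · (y z / (y + z)) = y z of neighbours in files j ± 1.
-- Reading this off at the moment promotion reaches file j gives the
-- recurrence  g (k+1) j · g k j = g (k+1) (j-1) · g k (j+1).
-- A purely algebraic "rotation" lemma then shows that the ratios
-- r k j = g k j / g k (j-1) move diagonally, r (k+1) j = r k (j+1), and
-- are therefore n-periodic in k; this forces ∏_{k<n} g k i = 1.

open import Defs
open import Data.Nat as N using (ℕ; zero; suc; z≤n; s≤s)
import Data.Nat.Properties as NP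
open import Data.Fin as F using (Fin; toℕ)
import Data.Fin.Properties as FP
open import Data.Product using (_×_; _,_; proj₁; proj₂)
open import Data.Sum using (_⊎_; inj₁; inj₂)
open import Data.Empty using (⊥; ⊥-elim)
open import Data.Unit using (⊤; tt)
open import Data.Bool using (Bool; true; false; if_then_else_)
open import Data.Maybe using (Maybe; nothing; just)
open import Data.List using (List; []; _∷_; _++_; map; foldr; foldl; filter; concatMap; cartesianProduct; tabulate; upTo; applyUpTo; allFin; _∷ʳ_)
import Data.List.Properties as LP
open import Data.List.Relation.Unary.All as All using (All)
import Data.List.Relation.Unary.All.Properties as AllP
open import Data.List.Relation.Unary.Any using (here; there)
open import Data.List.Membership.Propositional using (_∈_; _∉_)
import Data.List.Membership.Propositional.Properties as MP
open import Data.List.Relation.Unary.Unique.Propositional using (Unique)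
import Data.List.Relation.Unary.Unique.Propositional.Properties as UP
import Data.List.Relation.Unary.AllPairs as AP
open import Relation.Nullary using (¬_; yes; no; Dec)
open import Relation.Binary.PropositionalEquality as Eq using (_≡_; _≢_; refl; sym; trans; cong; cong₂; subst; subst₂)
open import Relation.Binary.Structures using (IsStrictTotalOrder)
open import Relation.Binary.Definitions using (tri<; tri≈; tri>)
open import Algebra.Bundles using (CommutativeRing; CommutativeSemiring; AbelianGroup)
open import Algebra.Structures using (IsCommutativeRing)
open import Function using (id)
open Eq.≡-Reasoning

module FieldFacts (R : Reals) where
  open Reals R
  open Promotion R using (parSum)
  open IsCommutativeRing isCommutativeRing public
    using (*-comm; *-assoc; *-identityˡ; *-identityʳ; +-identityˡ; +-identityʳ; zeroˡ; zeroʳ; -‿inverseʳ)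
  open IsStrictTotalOrder isStrictTotalOrder using (compare) renaming (irrefl to <-irrefl; trans to <-trans)

  commutativeRing : CommutativeRing _ _
  commutativeRing = record { isCommutativeRing = isCommutativeRing }

  private
    CS : CommutativeSemiring _ _
    CS = CommutativeRing.commutativeSemiring commutativeRing
    open import Algebra.Properties.Semiring.Mult (CommutativeSemiring.semiring CS) using () renaming (_×_ to _×ₙ_)

    numeral-≟ : ∀ m n → Maybe ((m ×ₙ 1#) ≡ (n ×ₙ 1#))
    numeral-≟ m n with m N.≟ n
    ... | yes e = just (cong (_×ₙ 1#) e)
    ... | no _ = nothing

  open import Algebra.Solver.Ring.NaturalCoefficients CS numeral-≟ public
  open import Algebra.Properties.Ring (CommutativeRing.ring commutativeRing) using (-‿distribˡ-*; -‿distribʳ-*)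
  open import Algebra.Properties.Group (AbelianGroup.group (CommutativeRing.+-abelianGroup commutativeRing)) using (⁻¹-involutive)

  inverseˡ : ∀ x → x ≢ 0# → (x ⁻¹) * x ≡ 1#
  inverseˡ x x≢0 = trans (*-comm _ _) (inverseʳ x x≢0)

  ⁻¹-cancelˡ : ∀ {x} y → x ≢ 0# → (x ⁻¹) * (x * y) ≡ y
  ⁻¹-cancelˡ {x} y x≢0 = begin
    (x ⁻¹) * (x * y) ≡⟨ sym (*-assoc _ _ _) ⟩
    ((x ⁻¹) * x) * y ≡⟨ cong (_* y) (inverseˡ x x≢0) ⟩
    1# * y           ≡⟨ *-identityˡ y ⟩
    y                ∎

  *-cancelˡ : ∀ {x u v} → x ≢ 0# → x * u ≡ x * v → u ≡ v
  *-cancelˡ {x} {u} {v} x≢0 e = begin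
    u                ≡⟨ sym (⁻¹-cancelˡ u x≢0) ⟩
    (x ⁻¹) * (x * u) ≡⟨ cong ((x ⁻¹) *_) e ⟩
    (x ⁻¹) * (x * v) ≡⟨ ⁻¹-cancelˡ v x≢0 ⟩
    v                ∎

  *-nonzero : ∀ {x y} → x ≢ 0# → y ≢ 0# → x * y ≢ 0#
  *-nonzero {x} {y} x≢0 y≢0 xy≡0 = y≢0 (begin
    y                ≡⟨ sym (⁻¹-cancelˡ y x≢0) ⟩
    (x ⁻¹) * (x * y) ≡⟨ cong ((x ⁻¹) *_) xy≡0 ⟩
    (x ⁻¹) * 0#      ≡⟨ zeroʳ _ ⟩
    0#               ∎)

  ⁻¹-nonzero : ∀ {x} → x ≢ 0# → x ⁻¹ ≢ 0#
  ⁻¹-nonzero {x} x≢0 x⁻¹≡0 = 0≢1 (begin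
    0#         ≡⟨ sym (zeroʳ x) ⟩
    x * 0#     ≡⟨ cong (x *_) (sym x⁻¹≡0) ⟩
    x * (x ⁻¹) ≡⟨ inverseʳ x x≢0 ⟩
    1#         ∎)

  ⁻¹-unique : ∀ {x y} → x * y ≡ 1# → x ⁻¹ ≡ y
  ⁻¹-unique {x} {y} xy≡1 = begin
    x ⁻¹              ≡⟨ sym (*-identityʳ _) ⟩
    (x ⁻¹) * 1#       ≡⟨ cong ((x ⁻¹) *_) (sym xy≡1) ⟩
    (x ⁻¹) * (x * y)  ≡⟨ ⁻¹-cancelˡ y x≢0 ⟩
    y                 ∎
    where
    x≢0 : x ≢ 0#
    x≢0 x≡0 = 0≢1 (begin 0# ≡⟨ sym (zeroˡ y) ⟩ 0# * y ≡⟨ cong (_* y) (sym x≡0) ⟩ x * y ≡⟨ xy≡1 ⟩ 1# ∎)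

  *-div-cancel : ∀ {x} y → x ≢ 0# → x * (y * (x ⁻¹)) ≡ y
  *-div-cancel {x} y x≢0 = begin
    x * (y * (x ⁻¹)) ≡⟨ solve 3 (λ x y z → (x :* (y :* z)) := (y :* (x :* z))) refl x y (x ⁻¹) ⟩
    y * (x * (x ⁻¹)) ≡⟨ cong (y *_) (inverseʳ x x≢0) ⟩
    y * 1#           ≡⟨ *-identityʳ y ⟩
    y                ∎

  cross-ratio : ∀ {x y z w} → x * y ≡ z * w → y ≢ 0# → z ≢ 0# → x * (z ⁻¹) ≡ w * (y ⁻¹)
  cross-ratio {x} {y} {z} {w} xy≡zw y≢0 z≢0 = begin
    x * (z ⁻¹)                  ≡⟨ sym (*-div-cancel (x * (z ⁻¹)) y≢0) ⟩
    y * ((x * (z ⁻¹)) * (y ⁻¹)) ≡⟨ solve 4 (λ y x zi yi → (y :* ((x :* zi) :* yi)) := (((x :* y) :* yi) :* zi)) refl y x (z ⁻¹) (y ⁻¹) ⟩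
    ((x * y) * (y ⁻¹)) * (z ⁻¹) ≡⟨ cong (λ t → (t * (y ⁻¹)) * (z ⁻¹)) xy≡zw ⟩
    ((z * w) * (y ⁻¹)) * (z ⁻¹) ≡⟨ solve 4 (λ z w yi zi → (((z :* w) :* yi) :* zi) := (z :* ((w :* yi) :* zi))) refl z w (y ⁻¹) (z ⁻¹) ⟩
    z * ((w * (y ⁻¹)) * (z ⁻¹)) ≡⟨ *-div-cancel (w * (y ⁻¹)) z≢0 ⟩
    w * (y ⁻¹)                  ∎

  pos⇒nonzero : ∀ {x} → 0# < x → x ≢ 0#
  pos⇒nonzero 0<x x≡0 = <-irrefl refl (subst (0# <_) x≡0 0<x)

  private
    <⇒0<difference : ∀ {x y} → x < y → 0# < (y + (- x))
    <⇒0<difference {x} {y} x<y = subst (_< (y + (- x))) (-‿inverseʳ x) (+-mono-< x y (- x) x<y)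

    <0⇒0<neg : ∀ {x} → x < 0# → 0# < (- x)
    <0⇒0<neg x<0 = subst (0# <_) (+-identityˡ _) (<⇒0<difference x<0)

    neg*neg : ∀ x → (- x) * (- x) ≡ x * x
    neg*neg x = trans (sym (-‿distribˡ-* x (- x))) (trans (cong -_ (sym (-‿distribʳ-* x x))) (⁻¹-involutive (x * x)))

  0<1 : 0# < 1#
  0<1 with compare 0# 1#
  ... | tri< 0<1 _ _ = 0<1
  ... | tri≈ _ 0≡1 _ = ⊥-elim (0≢1 0≡1)
  ... | tri> _ _ 1<0 = ⊥-elim (<-irrefl refl (<-trans 1<0 0<1′))
    where
    -- 1 = (-1)(-1) is a product of positives
    0<1′ : 0# < 1#
    0<1′ = subst (0# <_) (trans (neg*neg 1#) (*-identityˡ 1#)) (*-pos _ _ (<0⇒0<neg 1<0) (<0⇒0<neg 1<0))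

  pos-+ : ∀ {x y} → 0# < x → 0# < y → 0# < (x + y)
  pos-+ {x} {y} 0<x 0<y = <-trans 0<y (subst (_< (x + y)) (+-identityˡ y) (+-mono-< 0# x y 0<x))

  pos-⁻¹ : ∀ {x} → 0# < x → 0# < (x ⁻¹)
  pos-⁻¹ {x} 0<x with compare 0# (x ⁻¹)
  ... | tri< 0<x⁻¹ _ _ = 0<x⁻¹
  ... | tri≈ _ 0≡x⁻¹ _ = ⊥-elim (⁻¹-nonzero (pos⇒nonzero 0<x) (sym 0≡x⁻¹))
  ... | tri> _ _ x⁻¹<0 = ⊥-elim (<-irrefl refl (<-trans 0<-1 -1<0))
    where
    -- x · (-x⁻¹) = -1 would be positive
    0<-1 : 0# < (- 1#)
    0<-1 = subst (0# <_) (trans (sym (-‿distribʳ-* x (x ⁻¹))) (cong -_ (inverseʳ x (pos⇒nonzero 0<x))))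
                 (*-pos _ _ 0<x (<0⇒0<neg x⁻¹<0))
    -1<0 : (- 1#) < 0#
    -1<0 = subst₂ _<_ (+-identityˡ _) (-‿inverseʳ 1#) (+-mono-< 0# 1# (- 1#) 0<1)

  parSum-singleton : ∀ {x} → x ≢ 0# → parSum (x ∷ []) ≡ x
  parSum-singleton {x} x≢0 = ⁻¹-unique (trans (cong (_* x) (+-identityʳ _)) (inverseˡ x x≢0))

  -- the basic identity behind the whole theorem: (u + w) · (u ∥ w) = u w
  sum*parSum-pair : ∀ {u w} → 0# < u → 0# < w → (u + (w + 0#)) * parSum (w ∷ u ∷ []) ≡ u * w
  sum*parSum-pair {u} {w} 0<u 0<w = begin
      S * (I ⁻¹)             ≡⟨ cong (S *_) (⁻¹-unique I*uw/S≡1) ⟩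
      S * ((u * w) * (S ⁻¹)) ≡⟨ *-div-cancel (u * w) S≢0 ⟩
      u * w                  ∎
    where
    S = u + (w + 0#)
    I = (w ⁻¹) + ((u ⁻¹) + 0#)
    S≢0 : S ≢ 0#
    S≢0 = pos⇒nonzero (pos-+ 0<u (subst (0# <_) (sym (+-identityʳ w)) 0<w))
    I*uw/S≡1 : I * ((u * w) * (S ⁻¹)) ≡ 1#
    I*uw/S≡1 = begin
      I * ((u * w) * (S ⁻¹))
        ≡⟨ solve 5 (λ u w ui wi si → ((wi :+ (ui :+ con 0)) :* ((u :* w) :* si)) := ((((wi :* w) :* u) :+ ((ui :* u) :* w)) :* si))
                 refl u w (u ⁻¹) (w ⁻¹) (S ⁻¹) ⟩
      ((((w ⁻¹) * w) * u) + (((u ⁻¹) * u) * w)) * (S ⁻¹)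
        ≡⟨ cong₂ (λ s t → ((s * u) + (t * w)) * (S ⁻¹)) (inverseˡ w (pos⇒nonzero 0<w)) (inverseˡ u (pos⇒nonzero 0<u)) ⟩
      ((1# * u) + (1# * w)) * (S ⁻¹)
        ≡⟨ cong (_* (S ⁻¹)) (solve 2 (λ u w → ((con 1 :* u) :+ (con 1 :* w)) := (u :+ (w :+ con 0))) refl u w) ⟩
      S * (S ⁻¹)             ≡⟨ inverseʳ S S≢0 ⟩
      1#                     ∎

module Products (R : Reals) where
  open Reals R
  open Promotion R using (prodL)
  open FieldFacts R

  Π : ℕ → (ℕ → ℝ) → ℝ
  Π n f = prodL (applyUpTo f n)

  prodL-++ : ∀ xs ys → prodL (xs ++ ys) ≡ prodL xs * prodL ys
  prodL-++ [] ys = sym (*-identityˡ _)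
  prodL-++ (x ∷ xs) ys = trans (cong (x *_) (prodL-++ xs ys)) (sym (*-assoc _ _ _))

  Π-cong : ∀ n {f g : ℕ → ℝ} → (∀ k → k N.< n → f k ≡ g k) → Π n f ≡ Π n g
  Π-cong zero f≗g = refl
  Π-cong (suc n) f≗g = cong₂ _*_ (f≗g 0 (s≤s z≤n)) (Π-cong n (λ k k<n → f≗g (suc k) (s≤s k<n)))

  Π-snoc : ∀ n f → Π (suc n) f ≡ Π n f * f n
  Π-snoc n f = begin
    prodL (applyUpTo f (suc n))        ≡⟨ cong prodL (sym (LP.applyUpTo-∷ʳ f n)) ⟩
    prodL (applyUpTo f n ++ (f n ∷ [])) ≡⟨ prodL-++ (applyUpTo f n) _ ⟩
    Π n f * (f n * 1#)                 ≡⟨ cong (Π n f *_) (*-identityʳ _) ⟩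
    Π n f * f n                        ∎

  Π-* : ∀ n f g → Π n (λ k → f k * g k) ≡ Π n f * Π n g
  Π-* zero f g = sym (*-identityˡ _)
  Π-* (suc n) f g = begin
    (f 0 * g 0) * Π n (λ k → f (suc k) * g (suc k))               ≡⟨ cong ((f 0 * g 0) *_) (Π-* n (λ k → f (suc k)) (λ k → g (suc k))) ⟩
    (f 0 * g 0) * (Π n (λ k → f (suc k)) * Π n (λ k → g (suc k))) ≡⟨ solve 4 (λ a b c d → ((a :* b) :* (c :* d)) := ((a :* c) :* (b :* d))) refl (f 0) (g 0) _ _ ⟩
    (f 0 * Π n (λ k → f (suc k))) * (g 0 * Π n (λ k → g (suc k))) ∎

  Π-one : ∀ n → Π n (λ _ → 1#) ≡ 1#
  Π-one zero = refl
  Π-one (suc n) = trans (cong (1# *_) (Π-one n)) (*-identityʳ _)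

  Π-swap : ∀ n m (G : ℕ → ℕ → ℝ) → Π n (λ k → Π m (G k)) ≡ Π m (λ t → Π n (λ k → G k t))
  Π-swap n zero G = Π-one n
  Π-swap n (suc m) G = begin
    Π n (λ k → G k 0 * Π m (λ t → G k (suc t)))             ≡⟨ Π-* n (λ k → G k 0) (λ k → Π m (λ t → G k (suc t))) ⟩
    Π n (λ k → G k 0) * Π n (λ k → Π m (λ t → G k (suc t))) ≡⟨ cong (Π n (λ k → G k 0) *_) (Π-swap n m (λ k t → G k (suc t))) ⟩
    Π n (λ k → G k 0) * Π m (λ t → Π n (λ k → G k (suc t))) ∎

  Π-nonzero : ∀ n f → (∀ k → f k ≢ 0#) → Π n f ≢ 0#
  Π-nonzero zero f f≢0 = λ 1≡0 → 0≢1 (sym 1≡0)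
  Π-nonzero (suc n) f f≢0 = *-nonzero (f≢0 0) (Π-nonzero n (λ k → f (suc k)) (λ k → f≢0 (suc k)))

  Π-periodic-shift : ∀ n (h : ℕ → ℝ) → (∀ k → h k ≢ 0#) → (∀ k → h (k N.+ n) ≡ h k) →
                     ∀ c → Π n (λ k → h (k N.+ c)) ≡ Π n h
  Π-periodic-shift n h h≢0 periodic zero = Π-cong n (λ k _ → cong h (NP.+-identityʳ k))
  Π-periodic-shift n h h≢0 periodic (suc c) =
      trans (*-cancelˡ (h≢0 c) step) (Π-periodic-shift n h h≢0 periodic c)
    where
    f : ℕ → ℝ
    f k = h (k N.+ c)
    step : h c * Π n (λ k → h (k N.+ suc c)) ≡ h c * Π n f
    step = begin
      h c * Π n (λ k → h (k N.+ suc c)) ≡⟨ cong (h c *_) (Π-cong n (λ k _ → cong h (NP.+-suc k c))) ⟩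
      Π (suc n) f                        ≡⟨ Π-snoc n f ⟩
      Π n f * h (n N.+ c)                ≡⟨ cong (Π n f *_) (trans (cong h (NP.+-comm n c)) (periodic c)) ⟩
      Π n f * h c                        ≡⟨ *-comm _ _ ⟩
      h c * Π n f                        ∎

module Rotation (R : Reals) (g : ℕ → ℕ → Reals.ℝ R) (m : ℕ)
    (g≢0 : ∀ k j → g k j ≢ Reals.0# R)
    (g-left : ∀ k → g k 0 ≡ Reals.1# R) (g-right : ∀ k → g k (suc m) ≡ Reals.1# R)
    (recurrence : ∀ k j → 1 N.≤ j → j N.< suc m →
                  Reals._*_ R (g (suc k) j) (g k j) ≡ Reals._*_ R (g (suc k) (j N.∸ 1)) (g k (suc j))) where
  open Reals R
  open FieldFacts R
  open Products R

  n : ℕ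
  n = suc m

  r : ℕ → ℕ → ℝ
  r k j = g k j * (g k (j N.∸ 1)) ⁻¹

  r≢0 : ∀ k j → r k j ≢ 0#
  r≢0 k j = *-nonzero (g≢0 k j) (⁻¹-nonzero (g≢0 k _))

  r-step : ∀ k j → 1 N.≤ j → j N.< n → r (suc k) j ≡ r k (suc j)
  r-step k j 1≤j j<n = cross-ratio (recurrence k j 1≤j j<n) (g≢0 k j) (g≢0 (suc k) _)

  -- the ratios telescope back to g, since g k 0 = 1
  r-telescope : ∀ k l → Π l (λ t → r k (suc t)) ≡ g k l
  r-telescope k zero = sym (g-left k)
  r-telescope k (suc l) = begin
    Π (suc l) (λ t → r k (suc t))              ≡⟨ Π-snoc l _ ⟩
    Π l (λ t → r k (suc t)) * r k (suc l)      ≡⟨ cong (_* r k (suc l)) (r-telescope k l) ⟩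
    g k l * (g k (suc l) * (g k l) ⁻¹)         ≡⟨ *-div-cancel (g k (suc l)) (g≢0 k l) ⟩
    g k (suc l)                                ∎

  -- the ratios of a row multiply to g k n = 1; comparing rows k and k+1
  -- (all but one ratio agree by r-step) the last ratio wraps around
  r-wrap : ∀ k → r (suc k) n ≡ r k 1
  r-wrap k = *-cancelˡ (Π-nonzero m _ (λ t → r≢0 k (suc (suc t)))) (begin
      X * r (suc k) n                            ≡⟨ cong (_* r (suc k) n) (sym shifted) ⟩
      Π m (λ t → r (suc k) (suc t)) * r (suc k) n ≡⟨ sym (Π-snoc m _) ⟩
      Π n (λ t → r (suc k) (suc t))              ≡⟨ trans (r-telescope (suc k) n) (g-right (suc k)) ⟩
      1#                                         ≡⟨ sym (trans (r-telescope k n) (g-right k)) ⟩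
      Π n (λ t → r k (suc t))                    ≡⟨ *-comm _ _ ⟩
      X * r k 1                                  ∎)
    where
    X = Π m (λ t → r k (suc (suc t)))
    shifted : Π m (λ t → r (suc k) (suc t)) ≡ X
    shifted = Π-cong m (λ t t<m → r-step k (suc t) (s≤s z≤n) (s≤s t<m))

  r-diagonal : ∀ l k j → 1 N.≤ j → j N.+ l N.≤ n → r (k N.+ l) j ≡ r k (j N.+ l)
  r-diagonal zero k j _ _ = cong₂ r (NP.+-identityʳ k) (sym (NP.+-identityʳ j))
  r-diagonal (suc l) k j 1≤j j+l<n = begin
    r (k N.+ suc l) j     ≡⟨ cong (λ t → r t j) (NP.+-suc k l) ⟩
    r (suc (k N.+ l)) j   ≡⟨ r-step (k N.+ l) j 1≤j (NP.<-≤-trans (NP.m<m+n j (s≤s z≤n)) j+l<n) ⟩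
    r (k N.+ l) (suc j)   ≡⟨ r-diagonal l k (suc j) (s≤s z≤n) (subst (N._≤ n) (NP.+-suc j l) j+l<n) ⟩
    r k (suc j N.+ l)     ≡⟨ cong (r k) (sym (NP.+-suc j l)) ⟩
    r k (j N.+ suc l)     ∎

  first : ℕ → ℝ
  first k = r k 1

  first-periodic : ∀ k → first (k N.+ n) ≡ first k
  first-periodic k = begin
    r (k N.+ suc m) 1   ≡⟨ cong (λ t → r t 1) (NP.+-suc k m) ⟩
    r (suc k N.+ m) 1   ≡⟨ r-diagonal m (suc k) 1 (s≤s z≤n) NP.≤-refl ⟩
    r (suc k) n         ≡⟨ r-wrap k ⟩
    r k 1               ∎

  -- over a period, each column of ratios is a rotated copy of row 0
  column-product : ∀ j → 1 N.≤ j → j N.≤ n → Π n (λ k → r k j) ≡ 1#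
  column-product (suc j′) _ j≤n = begin
    Π n (λ k → r k (suc j′))     ≡⟨ Π-cong n (λ k _ → sym (r-diagonal j′ k 1 (s≤s z≤n) j≤n)) ⟩
    Π n (λ k → first (k N.+ j′)) ≡⟨ Π-periodic-shift n first (λ k → r≢0 k 1) first-periodic j′ ⟩
    Π n first                    ≡⟨ Π-cong n (λ k k<n → r-diagonal k 0 1 (s≤s z≤n) k<n) ⟩
    Π n (λ k → r 0 (suc k))      ≡⟨ trans (r-telescope 0 n) (g-right 0) ⟩
    1#                           ∎

  rotation : ∀ i → i N.≤ n → Π n (λ k → g k i) ≡ 1#
  rotation i i≤n = begin
    Π n (λ k → g k i)                     ≡⟨ Π-cong n (λ k _ → sym (r-telescope k i)) ⟩
    Π n (λ k → Π i (λ t → r k (suc t)))   ≡⟨ Π-swap n i (λ k t → r k (suc t)) ⟩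
    Π i (λ t → Π n (λ k → r k (suc t)))   ≡⟨ Π-cong i (λ t t<i → column-product (suc t) (s≤s z≤n) (NP.≤-trans t<i i≤n)) ⟩
    Π i (λ _ → 1#)                        ≡⟨ Π-one i ⟩
    1#                                    ∎

module Rectangle (a b : ℕ) where

  InGrid : ℕ → ℕ → Set
  InGrid d p = (a N.≤ d) × (p N.< a) × (d N.∸ a N.< b)

  column-in-range : ∀ d → a N.≤ d → d N.< a N.+ b → d N.∸ a N.< b
  column-in-range d a≤d d<n = NP.+-cancelʳ-< a _ _ (subst₂ N._<_ (sym (NP.m∸n+n≡m a≤d)) (NP.+-comm a b) d<n)

  -- For a file i = i′+1 and a row
  -- p′, the four positions
  --   bottom = file i, row p′        top  = file i, row p′+1
  --   right  = file i+1, row p′      left = file i-1, row p′+1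
  -- are the corners of a unit square, bottom and top being opposite.
  module UnitSquare (i′ p′ : ℕ) where
    private
      t : ℕ
      t = i′ N.+ p′

      +suc : i′ N.+ suc p′ ≡ suc t
      +suc = NP.+-suc i′ p′

      transport : ∀ {d d′ p} → d ≡ d′ → InGrid d p → InGrid d′ p
      transport refl g = g

    Top Bottom Right Left : Set
    Top = InGrid (suc (i′ N.+ suc p′)) (suc p′)
    Bottom = InGrid (suc t) p′
    Right = InGrid (suc (suc t)) p′
    Left = InGrid (i′ N.+ suc p′) (suc p′)

    top-bottom⇒right-left : Top → Bottom → Right × Left
    top-bottom⇒right-left top bottom =
      (NP.m≤n⇒m≤1+n (proj₁ bottom) , proj₁ (proj₂ bottom) , proj₂ (proj₂ (transport (cong suc +suc) top))) ,
      transport (sym +suc) (proj₁ bottom , proj₁ (proj₂ top) , proj₂ (proj₂ bottom))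

    right-left⇒top-bottom : Right → Left → Top × Bottom
    right-left⇒top-bottom right left =
      transport (sym (cong suc +suc)) (proj₁ right , proj₁ (proj₂ left) , proj₂ (proj₂ right)) ,
      (proj₁ (transport +suc left) , proj₁ (proj₂ right) , proj₂ (proj₂ (transport +suc left)))

    right⇒top-or-bottom : Right → Top ⊎ Bottom
    right⇒top-or-bottom (a≤d , p′<a , q<b) with suc p′ N.<? a
    ... | yes p′+1<a = inj₁ (transport (sym (cong suc +suc)) (a≤d , p′+1<a , q<b))
    ... | no p′+1≮a = inj₂ (NP.≤-trans (NP.≮⇒≥ p′+1≮a) (s≤s (NP.m≤n+m p′ i′)) , p′<a , NP.≤-<-trans (NP.∸-monoˡ-≤ a (NP.n≤1+n (suc t))) q<b)

    left⇒top-or-bottom : Left → Top ⊎ Bottom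
    left⇒top-or-bottom left with transport +suc left
    ... | (a≤d , p′+1<a , q<b) with suc (suc t) N.∸ a N.<? b
    ...   | yes q+1<b = inj₁ (transport (sym (cong suc +suc)) (NP.m≤n⇒m≤1+n a≤d , p′+1<a , q+1<b))
    ...   | no _ = inj₂ (a≤d , NP.<-trans (NP.n<1+n p′) p′+1<a , q<b)

module Grid (R : Reals) (a b : ℕ) where
  open Reals R
  open Promotion R
  open Products R
  open Rectangle a b public

  E : Set
  E = Elt a b

  fileOf-spec : ∀ (x : E) → fileOf x N.+ toℕ (proj₁ x) ≡ toℕ (proj₂ x) N.+ a
  fileOf-spec (p , q) = NP.m∸n+n≡m (NP.≤-trans (NP.<⇒≤ (FP.toℕ<n p)) (NP.m≤n+m a (toℕ q)))

  -- files are numbered 1, …, n-1; in particular files 0 and n are empty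
  fileOf-≥1 : ∀ (x : E) → 1 N.≤ fileOf x
  fileOf-≥1 (p , q) with fileOf {a} {b} (p , q) | fileOf-spec (p , q)
  ... | zero | e = ⊥-elim (NP.<⇒≱ (FP.toℕ<n p) (subst (a N.≤_) (sym e) (NP.m≤n+m a (toℕ q))))
  ... | suc _ | _ = s≤s z≤n

  fileOf-<n : ∀ (x : E) → fileOf x N.< a N.+ b
  fileOf-<n (p , q) = NP.+-cancelʳ-< (toℕ p) _ _ (subst (N._< (a N.+ b) N.+ toℕ p) (sym (fileOf-spec (p , q))) (NP.<-≤-trans q+a<b+a b+a≤n+p))
    where
    q+a<b+a : toℕ q N.+ a N.< b N.+ a
    q+a<b+a = NP.+-monoˡ-< a (FP.toℕ<n q)
    b+a≤n+p : b N.+ a N.≤ (a N.+ b) N.+ toℕ p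
    b+a≤n+p = subst (N._≤ (a N.+ b) N.+ toℕ p) (NP.+-comm a b) (NP.m≤m+n (a N.+ b) (toℕ p))

  line-other-file : ∀ (y z : E) →
    ((proj₁ y ≡ proj₁ z) × (toℕ (proj₂ y) ≢ toℕ (proj₂ z))) ⊎ ((proj₂ y ≡ proj₂ z) × (toℕ (proj₁ y) ≢ toℕ (proj₁ z))) →
    fileOf y ≢ fileOf z
  line-other-file (p , qy) (.p , qz) (inj₁ (refl , qy≢qz)) e =
    qy≢qz (NP.+-cancelʳ-≡ a _ _ (trans (sym (fileOf-spec (p , qy))) (trans (cong (N._+ toℕ p) e) (fileOf-spec (p , qz)))))
  line-other-file (py , q) (pz , .q) (inj₂ (refl , py≢pz)) e =
    py≢pz (NP.+-cancelˡ-≡ (fileOf {a} {b} (pz , q)) _ _ (trans (cong (N._+ toℕ py) (sym e)) (trans (fileOf-spec (py , q)) (sym (fileOf-spec (pz , q))))))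

  inFile? : ∀ i (x : E) → Dec (fileOf x ≡ i)
  inFile? i x = fileOf x N.≟ i

  private
    elements-product : ∀ (xs : List (Fin a)) → concatMap (λ p → map (λ q → (p , q)) (allFin b)) xs ≡ cartesianProduct xs (allFin b)
    elements-product [] = refl
    elements-product (x ∷ xs) = cong (map (λ q → (x , q)) (allFin b) ++_) (elements-product xs)

    elements-unique : Unique (elements a b)
    elements-unique = subst Unique (sym (elements-product (allFin a))) (UP.cartesianProduct⁺ (UP.allFin⁺ a) (UP.allFin⁺ b))

  file-unique : ∀ i → Unique (file a b i)
  file-unique i = UP.filter⁺ (inFile? i) elements-unique

  file-sound : ∀ i → All (λ x → fileOf x ≡ i) (file a b i)
  file-sound i = AllP.all-filter (inFile? i) (elements a b)

  fileProd-cong : ∀ i (s s′ : Labelling a b) → (∀ z → fileOf z ≡ i → s z ≡ s′ z) → fileProd a b i s ≡ fileProd a b i s′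
  fileProd-cong i s s′ s≗s′ = cong prodL (LP.map-cong-local (All.map (λ {z} → s≗s′ z) (file-sound i)))

  file-empty : ∀ i → (∀ (z : E) → fileOf z ≢ i) → file a b i ≡ []
  file-empty i nobody = LP.filter-none (inFile? i) {xs = elements a b} (All.tabulate (λ {z} _ → nobody z))

  -- Rows.  Every file meets row p in at most one element.  We describe
  -- the element with row p and "diagonal" d = q + a (so that the file is
  -- d - p) by the list  cell d p  of length 0 or 1.
  Coords : E → ℕ → ℕ → Set
  Coords x d p = (toℕ (proj₁ x) ≡ p) × (toℕ (proj₂ x) N.+ a ≡ d)

  cell : ℕ → ℕ → List E
  cell d p with a N.≤? d | p N.<? a | d N.∸ a N.<? b
  ... | yes _ | yes p<a | yes q<b = (F.fromℕ< p<a , F.fromℕ< q<b) ∷ []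
  ... | _ | _ | _ = []

  fileCell : ℕ → ℕ → List E
  fileCell j p = cell (j N.+ p) p

  fileCellAbove : ℕ → ℕ → List E
  fileCellAbove j zero = []
  fileCellAbove j (suc p) = fileCell j p

  Coords⇒q : ∀ {x d p} → Coords x d p → d N.∸ a ≡ toℕ (proj₂ x)
  Coords⇒q {x} (_ , q+a≡d) = trans (cong (N._∸ a) (sym q+a≡d)) (NP.m+n∸n≡m (toℕ (proj₂ x)) a)

  Coords⇒InGrid : ∀ {x d p} → Coords x d p → InGrid d p
  Coords⇒InGrid {x} c@(p≡ , q+a≡d) =
    subst (a N.≤_) q+a≡d (NP.m≤n+m a _) , subst (N._< a) p≡ (FP.toℕ<n _) , subst (N._< b) (sym (Coords⇒q {x} c)) (FP.toℕ<n _)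

  cell-present : ∀ x d p → Coords x d p → cell d p ≡ x ∷ []
  cell-present x d p c with a N.≤? d | p N.<? a | d N.∸ a N.<? b
  ... | yes _ | yes p<a | yes q<b = cong (_∷ []) (cong₂ _,_
        (FP.toℕ-injective (trans (FP.toℕ-fromℕ< p<a) (sym (proj₁ c))))
        (FP.toℕ-injective (trans (FP.toℕ-fromℕ< q<b) (Coords⇒q {x} c))))
  ... | no a≰d | _ | _ = ⊥-elim (a≰d (proj₁ (Coords⇒InGrid {x} c)))
  ... | yes _ | no p≮a | _ = ⊥-elim (p≮a (proj₁ (proj₂ (Coords⇒InGrid {x} c))))
  ... | yes _ | yes _ | no q≮b = ⊥-elim (q≮b (proj₂ (proj₂ (Coords⇒InGrid {x} c))))

  cell-absent : ∀ d p → ¬ InGrid d p → cell d p ≡ []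
  cell-absent d p ∉grid with a N.≤? d | p N.<? a | d N.∸ a N.<? b
  ... | yes a≤d | yes p<a | yes q<b = ⊥-elim (∉grid (a≤d , p<a , q<b))
  ... | no _ | _ | _ = refl
  ... | yes _ | no _ | _ = refl
  ... | yes _ | yes _ | no _ = refl

  data CellView (d p : ℕ) : Set where
    present : (x : E) → Coords x d p → cell d p ≡ x ∷ [] → CellView d p
    absent  : ¬ InGrid d p → cell d p ≡ [] → CellView d p

  cellView : ∀ d p → CellView d p
  cellView d p with a N.≤? d | p N.<? a | d N.∸ a N.<? b
  ... | yes a≤d | yes p<a | yes q<b = present x c (cell-present x d p c)
    where
    x : E
    x = F.fromℕ< p<a , F.fromℕ< q<b
    c : Coords x d p
    c = FP.toℕ-fromℕ< p<a , trans (cong (N._+ a) (FP.toℕ-fromℕ< q<b)) (NP.m∸n+n≡m a≤d)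
  ... | no a≰d | _ | _ = absent (λ g → a≰d (proj₁ g)) (cell-absent d p (λ g → a≰d (proj₁ g)))
  ... | yes _ | no p≮a | _ = absent (λ g → p≮a (proj₁ (proj₂ g))) (cell-absent d p (λ g → p≮a (proj₁ (proj₂ g))))
  ... | yes _ | yes _ | no q≮b = absent (λ g → q≮b (proj₂ (proj₂ g))) (cell-absent d p (λ g → q≮b (proj₂ (proj₂ g))))

  Coords-of-file : ∀ (y : E) j → fileOf y ≡ j → Coords y (j N.+ toℕ (proj₁ y)) (toℕ (proj₁ y))
  Coords-of-file y j fy≡j = refl , trans (sym (fileOf-spec y)) (cong (N._+ toℕ (proj₁ y)) fy≡j)

  file-of-Coords : ∀ x j p → Coords x (j N.+ p) p → fileOf x ≡ j
  file-of-Coords x j p (p≡ , q+a≡) = NP.+-cancelʳ-≡ p _ _ (trans (cong (fileOf x N.+_) (sym p≡)) (trans (fileOf-spec x) q+a≡))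

  private
    unique-singleton : ∀ {A : Set} {xs : List A} {x} → Unique xs → x ∈ xs → (∀ y → y ∈ xs → y ≡ x) → xs ≡ x ∷ []
    unique-singleton {xs = y ∷ []} _ _ all≡x = cong (_∷ []) (all≡x y (here refl))
    unique-singleton {xs = y ∷ w ∷ _} (y∉ AP.∷ _) _ all≡x =
      ⊥-elim (All.head y∉ (trans (all≡x y (here refl)) (sym (all≡x w (there (here refl))))))

    no-member-empty : ∀ {A : Set} {xs : List A} → (∀ y → y ∉ xs) → xs ≡ []
    no-member-empty {xs = []} _ = refl
    no-member-empty {xs = y ∷ _} none = ⊥-elim (none y (here refl))

    rowPart : ℕ → Fin a → List E
    rowPart j p = filter (inFile? j) (map (λ q → (p , q)) (allFin b))

    rowPart-member : ∀ j p y → y ∈ rowPart j p → (proj₁ y ≡ p) × (fileOf y ≡ j)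
    rowPart-member j p y y∈ with MP.∈-filter⁻ (inFile? j) {xs = map (λ q → (p , q)) (allFin b)} y∈
    ... | y∈row , fy≡j with MP.∈-map⁻ (λ q → (p , q)) y∈row
    ... | q , _ , refl = refl , fy≡j

    rowPart≡fileCell : ∀ j p → rowPart j p ≡ fileCell j (toℕ p)
    rowPart≡fileCell j p with cellView (j N.+ toℕ p) (toℕ p)
    ... | present x c eq = trans (unique-singleton unique x∈ all≡x) (sym eq)
      where
      unique : Unique (rowPart j p)
      unique = UP.filter⁺ (inFile? j) (UP.map⁺ (cong proj₂) (UP.allFin⁺ b))
      px≡p : proj₁ x ≡ p
      px≡p = FP.toℕ-injective (proj₁ c)
      x∈ : x ∈ rowPart j p
      x∈ = MP.∈-filter⁺ (inFile? j)
             (subst (λ t → (t , proj₂ x) ∈ map (λ q → (p , q)) (allFin b)) (sym px≡p) (MP.∈-map⁺ (λ q → (p , q)) (MP.∈-allFin (proj₂ x))))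
             (file-of-Coords x j (toℕ p) c)
      all≡x : ∀ y → y ∈ rowPart j p → y ≡ x
      all≡x y y∈ with rowPart-member j p y y∈
      ... | py , fy = cong₂ _,_ (trans py (sym px≡p))
              (FP.toℕ-injective (NP.+-cancelʳ-≡ a _ _ (trans (proj₂ (Coords-of-file y j fy)) (trans (cong (λ t → j N.+ toℕ t) py) (sym (proj₂ c))))))
    ... | absent ∉grid eq = trans (no-member-empty (λ y y∈ → let (py , fy) = rowPart-member j p y y∈ in
                                     ∉grid (Coords⇒InGrid {y} (subst (λ t → Coords y (j N.+ toℕ t) (toℕ t)) py (Coords-of-file y j fy)))))
                                  (sym eq)

    filter-concatMap : ∀ j (f : Fin a → List E) xs → filter (inFile? j) (concatMap f xs) ≡ concatMap (λ p → filter (inFile? j) (f p)) xs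
    filter-concatMap j f [] = refl
    filter-concatMap j f (x ∷ xs) =
      trans (LP.filter-++ (inFile? j) (f x) (concatMap f xs)) (cong (filter (inFile? j) (f x) ++_) (filter-concatMap j f xs))

    prodL-concatMap : ∀ (G : E → ℝ) (h : Fin a → List E) xs → prodL (map G (concatMap h xs)) ≡ prodL (map (λ p → prodL (map G (h p))) xs)
    prodL-concatMap G h [] = refl
    prodL-concatMap G h (x ∷ xs) = begin
      prodL (map G (h x ++ concatMap h xs))                  ≡⟨ cong prodL (LP.map-++ G (h x) (concatMap h xs)) ⟩
      prodL (map G (h x) ++ map G (concatMap h xs))          ≡⟨ prodL-++ (map G (h x)) _ ⟩
      prodL (map G (h x)) * prodL (map G (concatMap h xs))   ≡⟨ cong (prodL (map G (h x)) *_) (prodL-concatMap G h xs) ⟩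
      prodL (map G (h x)) * prodL (map (λ p → prodL (map G (h p))) xs) ∎

    prodL-tabulate : ∀ m (G : ℕ → ℝ) → prodL (tabulate {n = m} (λ p → G (toℕ p))) ≡ Π m G
    prodL-tabulate zero G = refl
    prodL-tabulate (suc m) G = cong (G 0 *_) (prodL-tabulate m (λ k → G (suc k)))

  prodL-file-by-rows : ∀ (G : E → ℝ) j → prodL (map G (file a b j)) ≡ Π a (λ p → prodL (map G (fileCell j p)))
  prodL-file-by-rows G j = begin
    prodL (map G (file a b j))
      ≡⟨ cong (λ l → prodL (map G l)) (filter-concatMap j (λ p → map (λ q → (p , q)) (allFin b)) (allFin a)) ⟩
    prodL (map G (concatMap (rowPart j) (allFin a)))
      ≡⟨ prodL-concatMap G (rowPart j) (allFin a) ⟩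
    prodL (map (λ p → prodL (map G (rowPart j p))) (allFin a))
      ≡⟨ cong prodL (LP.map-cong (λ p → cong (λ l → prodL (map G l)) (rowPart≡fileCell j p)) (allFin a)) ⟩
    prodL (map (λ p → prodL (map G (fileCell j (toℕ p)))) (allFin a))
      ≡⟨ cong prodL (LP.map-tabulate {n = a} id (λ p → prodL (map G (fileCell j (toℕ p))))) ⟩
    prodL (tabulate {n = a} (λ p → prodL (map G (fileCell j (toℕ p)))))
      ≡⟨ prodL-tabulate a (λ p → prodL (map G (fileCell j p))) ⟩
    Π a (λ p → prodL (map G (fileCell j p))) ∎

-- Toggles: φ_x changes only the value at x, and the new value depends
-- only on values outside the file of x.  Hence toggling a whole file
-- (whose elements are pairwise incomparable) replaces every value on it
-- by its toggle computed from the original labelling.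
module Toggles (R : Reals) (a b : ℕ) where
  open Reals R
  open Promotion R
  open Grid R a b

  toggled : Labelling a b → E → ℝ
  toggled s x = (sumL (map (ext s) (downCovers x)) * parSum (map (ext s) (upCovers x))) * (s x ⁻¹)

  private
    ≟E-true : ∀ (x y : E) → (x ≟E y) ≡ true → x ≡ y
    ≟E-true (p , q) (p′ , q′) with p F.≟ p′ | q F.≟ q′
    ... | yes refl | yes refl = λ _ → refl
    ... | yes _ | no _ = λ ()
    ... | no _ | yes _ = λ ()
    ... | no _ | no _ = λ ()

    ≟E-refl : ∀ (x : E) → (x ≟E x) ≡ true
    ≟E-refl (p , q) with p F.≟ p | q F.≟ q
    ... | yes _ | yes _ = refl
    ... | yes _ | no q≢q = ⊥-elim (q≢q refl)
    ... | no p≢p | _ = ⊥-elim (p≢p refl)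

  toggle-self : ∀ x (s : Labelling a b) → toggle x s x ≡ toggled s x
  toggle-self x s rewrite ≟E-refl x = refl

  toggle-other : ∀ x (s : Labelling a b) y → x ≢ y → toggle x s y ≡ s y
  toggle-other x s y x≢y with x ≟E y in eq
  ... | true = ⊥-elim (x≢y (≟E-true x y eq))
  ... | false = refl

  private
    prev-moves : ∀ {m} (p : Fin m) → All (λ p′ → toℕ p′ ≢ toℕ p) (prev p)
    prev-moves F.zero = All.[]
    prev-moves (F.suc i) = (λ e → NP.1+n≢n (sym (trans (sym (FP.toℕ-inject₁ i)) e))) All.∷ All.[]

    next-moves : ∀ {m} (p : Fin m) → All (λ p′ → toℕ p′ ≢ toℕ p) (next p)
    next-moves {m} p with suc (toℕ p) N.<? m
    ... | yes lt = (λ e → NP.1+n≢n (trans (sym (FP.toℕ-fromℕ< lt)) e)) All.∷ All.[]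
    ... | no _ = All.[]

    orElse-All : ∀ {A : Set} {P : A → Set} {xs : List A} {d} → All P xs → P d → All P (orElse xs d)
    orElse-All {xs = []} _ pd = pd All.∷ All.[]
    orElse-All {xs = _ ∷ _} pxs _ = pxs

  -- the covers of z lie outside the file of z, so labellings agreeing
  -- off that file (and at z) have the same toggle at z
  toggled-local : ∀ (s s′ : Labelling a b) z → (∀ y → fileOf y ≢ fileOf z → s y ≡ s′ y) → s z ≡ s′ z →
                  toggled s z ≡ toggled s′ z
  toggled-local s s′ (p , q) agree sz≡s′z =
      cong₂ _*_ (cong₂ (λ u v → sumL u * parSum v) (covers-agree prev prev-moves 0̂ refl) (covers-agree next next-moves 1̂ refl)) (cong _⁻¹ sz≡s′z)
    where
    covers-agree : ∀ (step : ∀ {m} → Fin m → List (Fin m)) → (∀ {m} (i : Fin m) → All (λ i′ → toℕ i′ ≢ toℕ i) (step i)) →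
      ∀ d → ext s d ≡ ext s′ d →
      map (ext s) (orElse (map (λ p′ → ⟨ (p′ , q) ⟩) (step p) ++ map (λ q′ → ⟨ (p , q′) ⟩) (step q)) d)
        ≡ map (ext s′) (orElse (map (λ p′ → ⟨ (p′ , q) ⟩) (step p) ++ map (λ q′ → ⟨ (p , q′) ⟩) (step q)) d)
    covers-agree step moves d d-agrees = LP.map-cong-local (orElse-All (AllP.++⁺
      (AllP.map⁺ (All.map (λ {p′} ne → agree (p′ , q) (line-other-file (p′ , q) (p , q) (inj₂ (refl , ne)))) (moves p)))
      (AllP.map⁺ (All.map (λ {q′} ne → agree (p , q′) (line-other-file (p , q′) (p , q) (inj₁ (refl , ne)))) (moves q)))) d-agrees)

  toggleAll-outside : ∀ xs (s : Labelling a b) z → All (λ x → x ≢ z) xs → toggleAll xs s z ≡ s z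
  toggleAll-outside [] s z _ = refl
  toggleAll-outside (x ∷ xs) s z (x≢z All.∷ xs∌z) = trans (toggleAll-outside xs (toggle x s) z xs∌z) (toggle-other x s z x≢z)

  toggleAll-file : ∀ xs (s : Labelling a b) z i → Unique xs → All (λ x → fileOf x ≡ i) xs → fileOf z ≡ i → z ∈ xs →
                   toggleAll xs s z ≡ toggled s z
  toggleAll-file (x ∷ xs) s z i (x∉xs AP.∷ _) _ _ (here refl) =
    trans (toggleAll-outside xs (toggle x s) x (All.map (λ ne e → ne (sym e)) x∉xs)) (toggle-self x s)
  toggleAll-file (x ∷ xs) s z i (x∉xs AP.∷ unique) (fx≡i All.∷ fxs≡i) fz≡i (there z∈xs) =
    trans (toggleAll-file xs (toggle x s) z i unique fxs≡i fz≡i z∈xs)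
      (toggled-local (toggle x s) s z
        (λ y fy≢fz → toggle-other x s y (λ x≡y → fy≢fz (trans (cong fileOf (sym x≡y)) (trans fx≡i (sym fz≡i)))))
        (toggle-other x s z (All.lookup x∉xs z∈xs)))

-- The covers of an element of file i = i′+1 in row p, expressed through
-- cells of the neighbouring files:
--   below: (p-1 , q) in file i+1, row p-1   and  (p , q-1) in file i-1, row p;
--   above: (p+1 , q) in file i-1, row p+1   and  (p , q+1) in file i+1, row p.
module Covers (R : Reals) (a b i′ : ℕ) where
  open Reals R
  open Promotion R
  open Grid R a b

  private
    down-row : ∀ (p : Fin a) (q : Fin b) → toℕ q N.+ a ≡ suc i′ N.+ toℕ p →
               map (λ p′ → (p′ , q)) (prev p) ≡ fileCellAbove (suc (suc i′)) (toℕ p)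
    down-row F.zero q _ = refl
    down-row (F.suc p′) q e = sym (cell-present (F.inject₁ p′ , q) (suc (suc i′) N.+ toℕ p′) (toℕ p′)
                                    (FP.toℕ-inject₁ p′ , trans e (NP.+-suc (suc i′) (toℕ p′))))

    down-column : ∀ (p : Fin a) (q : Fin b) → toℕ q N.+ a ≡ suc i′ N.+ toℕ p →
                  map (λ q′ → (p , q′)) (prev q) ≡ fileCell i′ (toℕ p)
    down-column p F.zero e = sym (cell-absent _ _ (λ g → NP.1+n≰n (subst (N._≤ i′ N.+ toℕ p) e (proj₁ g))))
    down-column p (F.suc q′) e = sym (cell-present (p , F.inject₁ q′) (i′ N.+ toℕ p) (toℕ p)
                                       (refl , trans (cong (N._+ a) (FP.toℕ-inject₁ q′)) (NP.suc-injective e)))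

    map-next : ∀ {m} {A : Set} (i : Fin m) (f : Fin m → A) (L : List A) →
               ((lt : suc (toℕ i) N.< m) → L ≡ f (F.fromℕ< lt) ∷ []) → (¬ (suc (toℕ i) N.< m) → L ≡ []) → map f (next i) ≡ L
    map-next {m} i f L at-next at-end with suc (toℕ i) N.<? m
    ... | yes lt = sym (at-next lt)
    ... | no ≮ = sym (at-end ≮)

    up-row : ∀ (p : Fin a) (q : Fin b) → toℕ q N.+ a ≡ suc i′ N.+ toℕ p →
             map (λ p′ → (p′ , q)) (next p) ≡ fileCell i′ (suc (toℕ p))
    up-row p q e = map-next p (λ p′ → (p′ , q)) _
      (λ lt → cell-present (F.fromℕ< lt , q) (i′ N.+ suc (toℕ p)) (suc (toℕ p)) (FP.toℕ-fromℕ< lt , trans e (sym (NP.+-suc i′ (toℕ p)))))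
      (λ ≮ → cell-absent _ _ (λ g → ≮ (proj₁ (proj₂ g))))

    up-column : ∀ (p : Fin a) (q : Fin b) → toℕ q N.+ a ≡ suc i′ N.+ toℕ p →
                map (λ q′ → (p , q′)) (next q) ≡ fileCell (suc (suc i′)) (toℕ p)
    up-column p q e = map-next q (λ q′ → (p , q′)) _
      (λ lt → cell-present (p , F.fromℕ< lt) (suc (suc i′) N.+ toℕ p) (toℕ p) (refl , trans (cong (N._+ a) (FP.toℕ-fromℕ< lt)) (cong suc e)))
      (λ ≮ → cell-absent _ _ (λ g → ≮ (subst (N._< b) q+1 (proj₂ (proj₂ g)))))
      where
      q+1 : suc (suc i′) N.+ toℕ p N.∸ a ≡ suc (toℕ q)
      q+1 = trans (cong (N._∸ a) (sym (cong suc e))) (NP.m+n∸n≡m (suc (toℕ q)) a)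

    map-ext-orElse : ∀ (s : Labelling a b) (hs : List (Hat a b)) d → ext s d ≡ 1# → map (ext s) (orElse hs d) ≡ orElse (map (ext s) hs) 1#
    map-ext-orElse s [] d d≡1 = cong (_∷ []) d≡1
    map-ext-orElse s (_ ∷ _) d _ = refl

    ext-⟨⟩ : ∀ (s : Labelling a b) {A : Set} (f : A → E) l → map (ext s) (map (λ u → ⟨ f u ⟩) l) ≡ map s (map f l)
    ext-⟨⟩ s f l = trans (sym (LP.map-∘ l)) (LP.map-∘ l)

    cover-values : ∀ (s : Labelling a b) (step : ∀ {m} → Fin m → List (Fin m)) d → ext s d ≡ 1# → ∀ (p : Fin a) (q : Fin b) →
      map (ext s) (orElse (map (λ p′ → ⟨ (p′ , q) ⟩) (step p) ++ map (λ q′ → ⟨ (p , q′) ⟩) (step q)) d)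
        ≡ orElse (map s (map (λ p′ → (p′ , q)) (step p) ++ map (λ q′ → (p , q′)) (step q))) 1#
    cover-values s step d d≡1 p q = begin
      map (ext s) (orElse (map (λ p′ → ⟨ (p′ , q) ⟩) (step p) ++ map (λ q′ → ⟨ (p , q′) ⟩) (step q)) d)
        ≡⟨ map-ext-orElse s _ d d≡1 ⟩
      orElse (map (ext s) (map (λ p′ → ⟨ (p′ , q) ⟩) (step p) ++ map (λ q′ → ⟨ (p , q′) ⟩) (step q))) 1#
        ≡⟨ cong (λ l → orElse l 1#) (trans (LP.map-++ (ext s) (map (λ p′ → ⟨ (p′ , q) ⟩) (step p)) (map (λ q′ → ⟨ (p , q′) ⟩) (step q)))
                                           (cong₂ _++_ (ext-⟨⟩ s _ (step p)) (ext-⟨⟩ s _ (step q)))) ⟩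
      orElse (map s (map (λ p′ → (p′ , q)) (step p)) ++ map s (map (λ q′ → (p , q′)) (step q))) 1#
        ≡⟨ cong (λ l → orElse l 1#) (sym (LP.map-++ s (map (λ p′ → (p′ , q)) (step p)) (map (λ q′ → (p , q′)) (step q)))) ⟩
      orElse (map s (map (λ p′ → (p′ , q)) (step p) ++ map (λ q′ → (p , q′)) (step q))) 1# ∎

  downCover-values : ∀ (s : Labelling a b) x p → Coords x (suc i′ N.+ p) p →
    map (ext s) (downCovers x) ≡ orElse (map s (fileCellAbove (suc (suc i′)) p ++ fileCell i′ p)) 1#
  downCover-values s (p , q) .(toℕ p) (refl , e) =
    trans (cover-values s prev 0̂ refl p q) (cong (λ l → orElse (map s l) 1#) (cong₂ _++_ (down-row p q e) (down-column p q e)))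

  upCover-values : ∀ (s : Labelling a b) x p → Coords x (suc i′ N.+ p) p →
    map (ext s) (upCovers x) ≡ orElse (map s (fileCell i′ (suc p) ++ fileCell (suc (suc i′)) p)) 1#
  upCover-values s (p , q) .(toℕ p) (refl , e) =
    trans (cover-values s next 1̂ refl p q) (cong (λ l → orElse (map s l) 1#) (cong₂ _++_ (up-row p q e) (up-column p q e)))

-- Since (φ s)(x) · s(x) = L_x R_x, it suffices to multiply L_x R_x over
-- the file.  Shifting the R-factors by one row, row p contributes
-- L_{x_p} · R_{x_{p-1}}, which involves exactly the two neighbours
--     y_p = file i+1, row p-1   and   z_p = file i-1, row p
-- and equals y_p z_p by  (y + z) (y ∥ z) = y z  (degenerate cases at the
-- boundary of the rectangle contribute 1 on both sides).
module FileIdentity (R : Reals) (a b : ℕ) (s : Promotion.Labelling R a b) (s-pos : ∀ x → Reals._<_ R (Reals.0# R) (s x))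
                    (i′ : ℕ) (i<n : suc i′ N.< a N.+ b) where
  open Reals R
  open Promotion R
  open FieldFacts R
  open Products R
  open Grid R a b
  open Toggles R a b
  open Covers R a b i′

  i : ℕ
  i = suc i′

  Lval Rval : E → ℝ
  Lval x = sumL (map (ext s) (downCovers x))
  Rval x = parSum (map (ext s) (upCovers x))

  lower upper upperShifted nextFile prevFile : ℕ → ℝ
  lower p = prodL (map Lval (fileCell i p))
  upper p = prodL (map Rval (fileCell i p))
  upperShifted zero = 1#
  upperShifted (suc p) = upper p
  nextFile p = prodL (map s (fileCellAbove (suc i) p))
  prevFile p = prodL (map s (fileCell i′ p))

  present? : ∀ {d p} → CellView d p → Bool
  present? (present _ _ _) = true
  present? (absent _ _) = false

  valueOf : ∀ {d p} → CellView d p → Maybe ℝ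
  valueOf (present x _ _) = just (s x)
  valueOf (absent _ _) = nothing

  asList : Maybe ℝ → List ℝ
  asList nothing = []
  asList (just u) = u ∷ []

  PositiveIfPresent : Maybe ℝ → Set
  PositiveIfPresent nothing = ⊤
  PositiveIfPresent (just u) = 0# < u

  valueOf-pos : ∀ {d p} (view : CellView d p) → PositiveIfPresent (valueOf view)
  valueOf-pos (present x _ _) = s-pos x
  valueOf-pos (absent _ _) = tt

  map-cell : ∀ {d p} (view : CellView d p) → map s (cell d p) ≡ asList (valueOf view)
  map-cell (present x _ eq) = cong (map s) eq
  map-cell (absent _ eq) = cong (map s) eq

  prodL-cell : ∀ {d p} (view : CellView d p) (G : E → ℝ) (K : ℝ) → (∀ x → Coords x d p → G x ≡ K) →
               prodL (map G (cell d p)) ≡ (if present? view then K * 1# else 1#)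
  prodL-cell (present x c eq) G K G≡K = trans (cong (λ l → prodL (map G l)) eq) (cong (_* 1#) (G≡K x c))
  prodL-cell (absent _ eq) G K _ = cong (λ l → prodL (map G l)) eq

  Consistent : Bool → Bool → Maybe ℝ → Maybe ℝ → Set
  Consistent true true (just _) (just _) = ⊤
  Consistent true true _ _ = ⊥
  Consistent false false nothing nothing = ⊤
  Consistent false false _ _ = ⊥
  Consistent _ _ (just _) (just _) = ⊥
  Consistent _ _ _ _ = ⊤

  square-factor : (top bottom : Bool) (right left : Maybe ℝ) → PositiveIfPresent right → PositiveIfPresent left →
    Consistent top bottom right left →
    (if top then sumL (orElse (asList right ++ asList left) 1#) * 1# else 1#)
      * (if bottom then parSum (orElse (asList left ++ asList right) 1#) * 1# else 1#)
    ≡ prodL (asList right) * prodL (asList left)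
  square-factor true true (just u) (just w) 0<u 0<w _ = begin
    ((u + (w + 0#)) * 1#) * (parSum (w ∷ u ∷ []) * 1#) ≡⟨ cong₂ _*_ (*-identityʳ _) (*-identityʳ _) ⟩
    (u + (w + 0#)) * parSum (w ∷ u ∷ [])              ≡⟨ sum*parSum-pair 0<u 0<w ⟩
    u * w                                              ≡⟨ sym (cong₂ _*_ (*-identityʳ u) (*-identityʳ w)) ⟩
    (u * 1#) * (w * 1#)                                ∎
  square-factor true false nothing nothing _ _ _ = solve 0 ((((con 1 :+ con 0) :* con 1) :* con 1) := (con 1 :* con 1)) refl
  square-factor true false (just u) nothing _ _ _ = solve 1 (λ u → (((u :+ con 0) :* con 1) :* con 1) := ((u :* con 1) :* con 1)) refl u
  square-factor true false nothing (just w) _ _ _ = solve 1 (λ w → (((w :+ con 0) :* con 1) :* con 1) := (con 1 :* (w :* con 1))) refl w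
  square-factor false true nothing nothing _ _ _ =
    trans (cong (λ t → 1# * (t * 1#)) (parSum-singleton (λ 1≡0 → 0≢1 (sym 1≡0)))) (solve 0 ((con 1 :* (con 1 :* con 1)) := (con 1 :* con 1)) refl)
  square-factor false true (just u) nothing 0<u _ _ =
    trans (cong (λ t → 1# * (t * 1#)) (parSum-singleton (pos⇒nonzero 0<u))) (solve 1 (λ u → (con 1 :* (u :* con 1)) := ((u :* con 1) :* con 1)) refl u)
  square-factor false true nothing (just w) _ 0<w _ =
    trans (cong (λ t → 1# * (t * 1#)) (parSum-singleton (pos⇒nonzero 0<w))) (solve 1 (λ w → (con 1 :* (w :* con 1)) := (con 1 :* (w :* con 1))) refl w)
  square-factor false false nothing nothing _ _ _ = refl

  -- in row 0 the bottom and right corners are missing; the left corner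
  -- exists only if the top one does (this uses i < n)
  first-row-consistent : (top : CellView (i N.+ 0) 0) (left : CellView (i′ N.+ 0) 0) →
                         Consistent (present? top) false nothing (valueOf left)
  first-row-consistent (present _ _ _) _ = tt
  first-row-consistent (absent _ _) (absent _ _) = tt
  first-row-consistent (absent ∉grid _) (present z c _) =
      ∉grid (NP.m≤n⇒m≤1+n a≤d , 0<a , column-in-range _ (NP.m≤n⇒m≤1+n a≤d) (subst (N._< a N.+ b) (cong suc (sym (NP.+-identityʳ i′))) i<n))
    where
    a≤d = proj₁ (Coords⇒InGrid {z} c)
    0<a = proj₁ (proj₂ (Coords⇒InGrid {z} c))

  module _ (p′ : ℕ) where
    open UnitSquare i′ p′

    square-consistent : (top : CellView (i N.+ suc p′) (suc p′)) (bottom : CellView (i N.+ p′) p′)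
      (right : CellView (suc i N.+ p′) p′) (left : CellView (i′ N.+ suc p′) (suc p′)) →
      Consistent (present? top) (present? bottom) (valueOf right) (valueOf left)
    square-consistent (present x cX _) (present y cY _) (present _ _ _) (present _ _ _) = tt
    square-consistent (present x cX _) (present y cY _) (present _ _ _) (absent ∉left _) =
      ∉left (proj₂ (top-bottom⇒right-left (Coords⇒InGrid {x} cX) (Coords⇒InGrid {y} cY)))
    square-consistent (present x cX _) (present y cY _) (absent ∉right _) _ =
      ∉right (proj₁ (top-bottom⇒right-left (Coords⇒InGrid {x} cX) (Coords⇒InGrid {y} cY)))
    square-consistent (present _ _ _) (absent ∉bottom _) (present y cY _) (present z cZ _) =
      ∉bottom (proj₂ (right-left⇒top-bottom (Coords⇒InGrid {y} cY) (Coords⇒InGrid {z} cZ)))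
    square-consistent (present _ _ _) (absent _ _) (present _ _ _) (absent _ _) = tt
    square-consistent (present _ _ _) (absent _ _) (absent _ _) _ = tt
    square-consistent (absent ∉top _) (present _ _ _) (present y cY _) (present z cZ _) =
      ∉top (proj₁ (right-left⇒top-bottom (Coords⇒InGrid {y} cY) (Coords⇒InGrid {z} cZ)))
    square-consistent (absent _ _) (present _ _ _) (present _ _ _) (absent _ _) = tt
    square-consistent (absent _ _) (present _ _ _) (absent _ _) _ = tt
    square-consistent (absent ∉top _) (absent ∉bottom _) (present y cY _) _ with right⇒top-or-bottom (Coords⇒InGrid {y} cY)
    ... | inj₁ top = ∉top top
    ... | inj₂ bottom = ∉bottom bottom
    square-consistent (absent ∉top _) (absent ∉bottom _) (absent _ _) (present z cZ _) with left⇒top-or-bottom (Coords⇒InGrid {z} cZ)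
    ... | inj₁ top = ∉top top
    ... | inj₂ bottom = ∉bottom bottom
    square-consistent (absent _ _) (absent _ _) (absent _ _) (absent _ _) = tt

  row-factor : ∀ p → lower p * upperShifted p ≡ nextFile p * prevFile p
  row-factor zero = begin
      lower 0 * 1#
        ≡⟨ cong (_* 1#) (prodL-cell top Lval _ (λ x c → cong sumL (downCover-values s x 0 c))) ⟩
      (if present? top then sumL (orElse (map s (fileCell i′ 0)) 1#) * 1# else 1#) * 1#
        ≡⟨ cong (λ l → (if present? top then sumL (orElse l 1#) * 1# else 1#) * 1#) (map-cell left) ⟩
      (if present? top then sumL (orElse (asList (valueOf left)) 1#) * 1# else 1#) * 1#
        ≡⟨ square-factor (present? top) false nothing (valueOf left) tt (valueOf-pos left) (first-row-consistent top left) ⟩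
      1# * prodL (asList (valueOf left))
        ≡⟨ cong (λ l → 1# * prodL l) (sym (map-cell left)) ⟩
      1# * prevFile 0 ∎
    where
    top = cellView (i N.+ 0) 0
    left = cellView (i′ N.+ 0) 0
  row-factor (suc p′) = begin
      lower (suc p′) * upper p′
        ≡⟨ cong₂ _*_ (prodL-cell top Lval _ (λ x c → cong sumL (downCover-values s x (suc p′) c)))
                     (prodL-cell bottom Rval _ (λ x c → cong parSum (upCover-values s x p′ c))) ⟩
      (if present? top then sumL (orElse (map s (rightCell ++ leftCell)) 1#) * 1# else 1#)
        * (if present? bottom then parSum (orElse (map s (leftCell ++ rightCell)) 1#) * 1# else 1#)
        ≡⟨ cong₂ (λ l l′ → (if present? top then sumL (orElse l 1#) * 1# else 1#) * (if present? bottom then parSum (orElse l′ 1#) * 1# else 1#))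
                 (map-cells right left) (map-cells left right) ⟩
      (if present? top then sumL (orElse (asList (valueOf right) ++ asList (valueOf left)) 1#) * 1# else 1#)
        * (if present? bottom then parSum (orElse (asList (valueOf left) ++ asList (valueOf right)) 1#) * 1# else 1#)
        ≡⟨ square-factor (present? top) (present? bottom) (valueOf right) (valueOf left) (valueOf-pos right) (valueOf-pos left)
                         (square-consistent p′ top bottom right left) ⟩
      prodL (asList (valueOf right)) * prodL (asList (valueOf left))
        ≡⟨ cong₂ (λ l l′ → prodL l * prodL l′) (sym (map-cell right)) (sym (map-cell left)) ⟩
      nextFile (suc p′) * prevFile (suc p′) ∎
    where
    top = cellView (i N.+ suc p′) (suc p′)
    bottom = cellView (i N.+ p′) p′
    right = cellView (suc i N.+ p′) p′
    left = cellView (i′ N.+ suc p′) (suc p′)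
    rightCell = fileCell (suc i) p′
    leftCell = fileCell i′ (suc p′)
    map-cells : ∀ {d p d′ p′} (v : CellView d p) (v′ : CellView d′ p′) →
                map s (cell d p ++ cell d′ p′) ≡ asList (valueOf v) ++ asList (valueOf v′)
    map-cells {d} {p} {d′} {p′} v v′ = trans (LP.map-++ s (cell d p) (cell d′ p′)) (cong₂ _++_ (map-cell v) (map-cell v′))

  private
    fileCell-end : ∀ j → fileCell j a ≡ []
    fileCell-end j = cell-absent _ _ (λ g → NP.n≮n a (proj₁ (proj₂ g)))

    prodL-map-* : ∀ (f g : E → ℝ) l → prodL (map (λ x → f x * g x) l) ≡ prodL (map f l) * prodL (map g l)
    prodL-map-* f g [] = sym (*-identityˡ _)
    prodL-map-* f g (x ∷ l) = trans (cong ((f x * g x) *_) (prodL-map-* f g l))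
                                     (solve 4 (λ a b c d → ((a :* b) :* (c :* d)) := ((a :* c) :* (b :* d))) refl (f x) (g x) _ _)

    -- appending the empty row a does not change the products
    Π-lower-extend : Π (suc a) lower ≡ Π a lower
    Π-lower-extend = trans (Π-snoc a lower) (trans (cong (λ l → Π a lower * prodL (map Lval l)) (fileCell-end i)) (*-identityʳ _))

    Π-prevFile-extend : Π (suc a) prevFile ≡ Π a prevFile
    Π-prevFile-extend = trans (Π-snoc a prevFile) (trans (cong (λ l → Π a prevFile * prodL (map s l)) (fileCell-end i′)) (*-identityʳ _))

  file-telescopes : Π a (λ p → prodL (map (λ x → Lval x * Rval x) (fileCell i p)))
                    ≡ Π a prevFile * Π a (λ p → prodL (map s (fileCell (suc i) p)))
  file-telescopes = begin
    Π a (λ p → prodL (map (λ x → Lval x * Rval x) (fileCell i p))) ≡⟨ Π-cong a (λ p _ → prodL-map-* Lval Rval (fileCell i p)) ⟩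
    Π a (λ p → lower p * upper p)                     ≡⟨ Π-* a lower upper ⟩
    Π a lower * Π a upper                             ≡⟨ cong₂ _*_ (sym Π-lower-extend) (sym (*-identityˡ _)) ⟩
    Π (suc a) lower * Π (suc a) upperShifted          ≡⟨ sym (Π-* (suc a) lower upperShifted) ⟩
    Π (suc a) (λ p → lower p * upperShifted p)        ≡⟨ Π-cong (suc a) (λ p _ → row-factor p) ⟩
    Π (suc a) (λ p → nextFile p * prevFile p)         ≡⟨ Π-* (suc a) nextFile prevFile ⟩
    Π (suc a) nextFile * Π (suc a) prevFile           ≡⟨ cong₂ _*_ (*-identityˡ _) Π-prevFile-extend ⟩
    Π a (λ p → prodL (map s (fileCell (suc i) p))) * Π a prevFile ≡⟨ *-comm _ _ ⟩
    Π a prevFile * Π a (λ p → prodL (map s (fileCell (suc i) p))) ∎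

  toggled-file-identity : fileProd a b i (toggleAll (file a b i) s) * fileProd a b i s ≡ fileProd a b i′ s * fileProd a b (suc i) s
  toggled-file-identity = begin
    prodL (map (toggleAll Fi s) Fi) * prodL (map s Fi)
      ≡⟨ cong (λ l → prodL l * prodL (map s Fi)) (LP.map-cong-local (All.tabulate (λ {z} z∈ →
           toggleAll-file Fi s z i (file-unique i) (file-sound i) (All.lookup (file-sound i) z∈) z∈))) ⟩
    prodL (map (toggled s) Fi) * prodL (map s Fi)    ≡⟨ sym (prodL-map-* (toggled s) s Fi) ⟩
    prodL (map (λ x → toggled s x * s x) Fi)         ≡⟨ cong prodL (LP.map-cong toggled*s Fi) ⟩
    prodL (map (λ x → Lval x * Rval x) Fi)           ≡⟨ prodL-file-by-rows (λ x → Lval x * Rval x) i ⟩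
    Π a (λ p → prodL (map (λ x → Lval x * Rval x) (fileCell i p))) ≡⟨ file-telescopes ⟩
    Π a prevFile * Π a (λ p → prodL (map s (fileCell (suc i) p))) ≡⟨ sym (cong₂ _*_ (prodL-file-by-rows s i′) (prodL-file-by-rows s (suc i))) ⟩
    prodL (map s (file a b i′)) * prodL (map s (file a b (suc i))) ∎
    where
    Fi = file a b i
    toggled*s : ∀ x → toggled s x * s x ≡ Lval x * Rval x
    toggled*s x = begin
      ((Lval x * Rval x) * (s x ⁻¹)) * s x ≡⟨ *-assoc _ _ _ ⟩
      (Lval x * Rval x) * ((s x ⁻¹) * s x) ≡⟨ cong ((Lval x * Rval x) *_) (inverseˡ (s x) (pos⇒nonzero (s-pos x))) ⟩
      (Lval x * Rval x) * 1#               ≡⟨ *-identityʳ _ ⟩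
      Lval x * Rval x                      ∎

module Positivity (R : Reals) (a b : ℕ) where
  open Reals R
  open Promotion R
  open FieldFacts R
  open Toggles R a b

  Positive : Labelling a b → Set
  Positive s = ∀ x → 0# < s x

  private
    Σ-pos : (g : ℝ → ℝ) → (∀ {u} → 0# < u → 0# < g u) →
            ∀ x xs → All (0# <_) (x ∷ xs) → 0# < foldr (λ u acc → g u + acc) 0# (x ∷ xs)
    Σ-pos g g-pos x [] (0<x All.∷ All.[]) = subst (0# <_) (sym (+-identityʳ _)) (g-pos 0<x)
    Σ-pos g g-pos x (y ∷ ys) (0<x All.∷ 0<ys) = pos-+ (g-pos 0<x) (Σ-pos g g-pos y ys 0<ys)

  module _ (s : Labelling a b) (s-pos : Positive s) where
    private
      ext-pos : ∀ hs → All (0# <_) (map (ext s) hs)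
      ext-pos [] = All.[]
      ext-pos (0̂ ∷ hs) = 0<1 All.∷ ext-pos hs
      ext-pos (1̂ ∷ hs) = 0<1 All.∷ ext-pos hs
      ext-pos (⟨ x ⟩ ∷ hs) = s-pos x All.∷ ext-pos hs

      -- a list of covers completed by orElse is never empty
      covers-Σ-pos : (g : ℝ → ℝ) → (∀ {u} → 0# < u → 0# < g u) → ∀ hs d →
                     0# < foldr (λ u acc → g u + acc) 0# (map (ext s) (orElse hs d))
      covers-Σ-pos g g-pos [] d = Σ-pos g g-pos _ _ (ext-pos (d ∷ []))
      covers-Σ-pos g g-pos (h ∷ hs) d = Σ-pos g g-pos _ _ (ext-pos (h ∷ hs))

    toggled-pos : ∀ x → 0# < toggled s x
    toggled-pos (p , q) = *-pos _ _
      (*-pos _ _ (covers-Σ-pos id id (map (λ p′ → ⟨ (p′ , q) ⟩) (prev p) ++ map (λ q′ → ⟨ (p , q′) ⟩) (prev q)) 0̂)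
                 (pos-⁻¹ (covers-Σ-pos _⁻¹ pos-⁻¹ (map (λ p′ → ⟨ (p′ , q) ⟩) (next p) ++ map (λ q′ → ⟨ (p , q′) ⟩) (next q)) 1̂)))
      (pos-⁻¹ (s-pos (p , q)))

    toggle-pos : ∀ x → Positive (toggle x s)
    toggle-pos x y with x ≟E y
    ... | true = toggled-pos x
    ... | false = s-pos y

  toggleAll-pos : ∀ xs s → Positive s → Positive (toggleAll xs s)
  toggleAll-pos [] s s-pos = s-pos
  toggleAll-pos (x ∷ xs) s s-pos = toggleAll-pos xs (toggle x s) (toggle-pos s s-pos x)

  toggleFiles-pos : ∀ js s → Positive s → Positive (foldl (λ w j → toggleAll (file a b j) w) s js)
  toggleFiles-pos [] s s-pos = s-pos
  toggleFiles-pos (j ∷ js) s s-pos = toggleFiles-pos js (toggleAll (file a b j) s) (toggleAll-pos (file a b j) s s-pos)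

  iter-promotion-pos : ∀ k s → Positive s → Positive (iter k (promotion a b) s)
  iter-promotion-pos zero s s-pos = s-pos
  iter-promotion-pos (suc k) s s-pos = toggleFiles-pos (map suc (upTo (a N.+ b N.∸ 1))) (iter k (promotion a b) s) (iter-promotion-pos k s s-pos)

  prodL-pos : ∀ (s : Labelling a b) → Positive s → ∀ xs → 0# < prodL (map s xs)
  prodL-pos s s-pos [] = 0<1
  prodL-pos s s-pos (x ∷ xs) = *-pos _ _ (s-pos x) (prodL-pos s s-pos xs)

-- How promotion acts file by file: an element of file j is changed only
-- when file j is toggled, so its value after promotion is its toggle
-- computed from the labelling obtained by toggling files 1, …, j-1.
module PromotionByFiles (R : Reals) (a b : ℕ) where
  open Promotion R
  open Grid R a b
  open Toggles R a b

  toggleFile : Labelling a b → ℕ → Labelling a b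
  toggleFile w j = toggleAll (file a b j) w

  toggledUpTo : ℕ → Labelling a b → Labelling a b
  toggledUpTo j w = foldl toggleFile w (applyUpTo suc j)

  private
    last-file : ℕ
    last-file = a N.+ b N.∸ 1

    toggleFile-outside : ∀ w j z → j ≢ fileOf z → toggleFile w j z ≡ w z
    toggleFile-outside w j z j≢fz =
      toggleAll-outside (file a b j) w z (All.map (λ {x} fx≡j x≡z → j≢fz (trans (sym fx≡j) (cong fileOf x≡z))) (file-sound j))

    toggleFiles-outside : ∀ js w z → All (λ j → j ≢ fileOf z) js → foldl toggleFile w js z ≡ w z
    toggleFiles-outside [] w z _ = refl
    toggleFiles-outside (j ∷ js) w z (j≢fz All.∷ js∌fz) = trans (toggleFiles-outside js (toggleFile w j) z js∌fz) (toggleFile-outside w j z j≢fz)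

    applyUpTo-++ : ∀ (f : ℕ → ℕ) m k → applyUpTo f (m N.+ k) ≡ applyUpTo f m ++ applyUpTo (λ t → f (m N.+ t)) k
    applyUpTo-++ f zero k = refl
    applyUpTo-++ f (suc m) k = cong (f 0 ∷_) (applyUpTo-++ (λ t → f (suc t)) m k)

    All-applyUpTo : ∀ {P : ℕ → Set} (f : ℕ → ℕ) m → (∀ t → t N.< m → P (f t)) → All P (applyUpTo f m)
    All-applyUpTo f zero _ = All.[]
    All-applyUpTo f (suc m) P-f = P-f 0 (s≤s z≤n) All.∷ All-applyUpTo (λ t → f (suc t)) m (λ t t<m → P-f (suc t) (s≤s t<m))

  toggledUpTo-beyond : ∀ j w z → suc j N.≤ fileOf z → toggledUpTo j w z ≡ w z
  toggledUpTo-beyond j w z j<fz = toggleFiles-outside _ w z (All-applyUpTo suc j (λ t t<j t+1≡fz → NP.<-irrefl t+1≡fz (NP.<-≤-trans (s≤s t<j) j<fz)))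

  promotion-on-file : ∀ j w z → suc j N.≤ last-file → fileOf z ≡ suc j →
                      promotion a b w z ≡ toggleFile (toggledUpTo j w) (suc j) z
  promotion-on-file j w z j<last fz≡j+1 = begin
      promotion a b w z                              ≡⟨ cong (λ l → foldl toggleFile w l z) (LP.map-upTo suc last-file) ⟩
      foldl toggleFile w (applyUpTo suc last-file) z ≡⟨ cong (λ l → foldl toggleFile w l z) (trans (sym (cong (applyUpTo suc) split)) (applyUpTo-++ suc j (suc rest))) ⟩
      foldl toggleFile w (applyUpTo suc j ++ (suc (j N.+ 0) ∷ later)) z ≡⟨ cong (λ u → u z) (LP.foldl-++ toggleFile w (applyUpTo suc j) _) ⟩
      foldl toggleFile (toggleFile (toggledUpTo j w) (suc (j N.+ 0))) later z ≡⟨ toggleFiles-outside later _ z later-files ⟩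
      toggleFile (toggledUpTo j w) (suc (j N.+ 0)) z ≡⟨ cong (λ t → toggleFile (toggledUpTo j w) (suc t) z) (NP.+-identityʳ j) ⟩
      toggleFile (toggledUpTo j w) (suc j) z         ∎
    where
    rest = last-file N.∸ suc j
    later = applyUpTo (λ t → suc (j N.+ suc t)) rest
    split : j N.+ suc rest ≡ last-file
    split = trans (NP.+-suc j rest) (NP.m+[n∸m]≡n j<last)
    later-files : All (λ t → t ≢ fileOf z) later
    later-files = All-applyUpTo _ rest (λ t _ e → NP.m≢1+m+n j (sym (trans (sym (NP.+-suc j t)) (NP.suc-injective (trans e fz≡j+1)))))

  toggledUpTo-file : ∀ j w z → suc (suc j) N.≤ last-file → fileOf z ≡ suc j → toggledUpTo (suc j) w z ≡ promotion a b w z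
  toggledUpTo-file j w z j+1<last fz≡j+1 = begin
    toggledUpTo (suc j) w z                                ≡⟨ cong (λ l → foldl toggleFile w l z) (sym (LP.applyUpTo-∷ʳ suc j)) ⟩
    foldl toggleFile w (applyUpTo suc j ∷ʳ suc j) z        ≡⟨ cong (λ u → u z) (LP.foldl-∷ʳ toggleFile w (suc j) (applyUpTo suc j)) ⟩
    toggleFile (toggledUpTo j w) (suc j) z                 ≡⟨ sym (promotion-on-file j w z (NP.<⇒≤ j+1<last) fz≡j+1) ⟩
    promotion a b w z                                      ∎

module FileProducts (R : Reals) (a′ b : ℕ) (v : Promotion.Labelling R (suc a′) b)
                    (v-pos : ∀ x → Reals._<_ R (Reals.0# R) (v x)) where
  open Reals R
  open Promotion R
  open FieldFacts R
  open Products R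
  open Grid R (suc a′) b
  open Positivity R (suc a′) b
  open PromotionByFiles R (suc a′) b

  a : ℕ
  a = suc a′

  g : ℕ → ℕ → ℝ
  g k j = fileProd a b j (iter k (promotion a b) v)

  g≢0 : ∀ k j → g k j ≢ 0#
  g≢0 k j = pos⇒nonzero (prodL-pos _ (iter-promotion-pos k v v-pos) (file a b j))

  file0-empty : file a b 0 ≡ []
  file0-empty = file-empty 0 (λ z fz≡0 → NP.<⇒≱ (fileOf-≥1 z) (NP.≤-reflexive fz≡0))

  g-left : ∀ k → g k 0 ≡ 1#
  g-left k = cong (λ l → prodL (map (iter k (promotion a b) v) l)) file0-empty

  g-right : ∀ k → g k (suc (a′ N.+ b)) ≡ 1#
  g-right k = cong (λ l → prodL (map (iter k (promotion a b) v) l)) (file-empty (a N.+ b) (λ z fz≡n → NP.<-irrefl fz≡n (fileOf-<n z)))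

  -- toggling file j, read off at the moment promotion reaches it
  recurrence : ∀ k j → 1 N.≤ j → j N.< suc (a′ N.+ b) → g (suc k) j * g k j ≡ g (suc k) (j N.∸ 1) * g k (suc j)
  recurrence k (suc j′) _ j<n = begin
      g (suc k) (suc j′) * g k (suc j′)
        ≡⟨ cong₂ _*_ (fileProd-cong (suc j′) _ _ (λ z fz → promotion-on-file j′ w z j<last fz))
                     (sym (fileProd-cong (suc j′) _ _ (λ z fz → toggledUpTo-beyond j′ w z (NP.≤-reflexive (sym fz))))) ⟩
      fileProd a b (suc j′) (toggleAll (file a b (suc j′)) s) * fileProd a b (suc j′) s
        ≡⟨ FileIdentity.toggled-file-identity R a b s s-pos j′ j<n ⟩
      fileProd a b j′ s * fileProd a b (suc (suc j′)) s
        ≡⟨ cong₂ _*_ (previous-file j′ j<last)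
                     (fileProd-cong (suc (suc j′)) _ _ (λ z fz → toggledUpTo-beyond j′ w z (subst (suc j′ N.≤_) (sym fz) (NP.n≤1+n (suc j′))))) ⟩
      g (suc k) j′ * g k (suc (suc j′)) ∎
    where
    w = iter k (promotion a b) v
    s = toggledUpTo j′ w
    s-pos : Positive s
    s-pos = toggleFiles-pos (applyUpTo suc j′) w (iter-promotion-pos k v v-pos)
    j<last : suc j′ N.≤ a N.+ b N.∸ 1
    j<last = NP.≤-pred j<n
    previous-file : ∀ j″ → suc j″ N.≤ a N.+ b N.∸ 1 → fileProd a b j″ (toggledUpTo j″ w) ≡ fileProd a b j″ (promotion a b w)
    previous-file zero _ = trans (cong (λ l → prodL (map (toggledUpTo 0 w) l)) file0-empty) (sym (cong (λ l → prodL (map (promotion a b w) l)) file0-empty))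
    previous-file (suc j‴) j‴<last = fileProd-cong (suc j‴) _ _ (λ z fz → toggledUpTo-file j‴ w z j‴<last fz)

  period-product : ∀ i → i N.≤ a N.+ b N.∸ 1 → prodL (map (λ k → g k i) (upTo (a N.+ b))) ≡ 1#
  period-product i i≤ = begin
    prodL (map (λ k → g k i) (upTo (a N.+ b))) ≡⟨ cong prodL (LP.map-upTo (λ k → g k i) (a N.+ b)) ⟩
    Π (a N.+ b) (λ k → g k i)                  ≡⟨ Rotation.rotation R g (a′ N.+ b) g≢0 g-left g-right recurrence i (NP.≤-trans i≤ (NP.n≤1+n _)) ⟩
    1#                                         ∎

-- the statement uses unqualified arithmetic on ℕ (not the field's _+_)
open import Data.Nat using (_+_; _∸_; _≤_)

-- The theorem: combine the rotation lemma with the recurrence for the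
-- file products.
mainTheorem6 : (R : Reals) → let open Promotion R in
    (a b : ℕ) → 1 ≤ a → 1 ≤ b →
    (v : Labelling a b) → (∀ x → Reals._<_ R (Reals.0# R) (v x)) →
    (i : ℕ) → 1 ≤ i → i ≤ (a + b) ∸ 1 →
    prodL (map (λ k → fileProd a b i (iter k (promotion a b) v)) (upTo (a + b)))
    ≡ Reals.1# R
mainTheorem6 R (suc a′) b _ _ v v-pos i _ i≤n-1 = FileProducts.period-product R a′ b v v-pos i i≤n-1
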